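{- For every $n\ge 2$, the map $\psi$ is a bijection from the set $\mathcal C_{a,n}$ of active convex permutominoes of size $n$ onto the set $\mathcal C_{n-1}$ of convex permutominoes of size $n-1$. Its inverse sends $P'\in\mathcal C_{n-1}$ to the polyomino obtained by inserting, immediately below the row $\varrho'$ of $P'$ that contains the leftmost boundary point of minimal ordinate, a new row that extends one cell further to the left than $\varrho'$ and ends at the same abscissa as $\varrho'$.
   Context: A cell is a closed unit square with vertices in $\mathbb Z^2$. A polyomino is a finite connected union of cells having no cut point, considered up to translation. A polyomino is convex if its intersection with every horizontal line and with every vertical line is connected. Permutominoes. Let $P$ be a polyomino without holes having $n$ rows and $n$ columns. Translate it so that its minimal bounding square has bottom-left corner $(1,1)$. List the boundary vertices (corners) of $P$ in clockwise order as $A_1,\dots,A_{2(r+1)}$, where $A_1$ is the leftmost boundary point with minimal ordinate. $P$ is a permutomino of size $n$ if both $\{A_1,A_3,\dots,A_{2r+1}\}$ and $\{A_2,A_4,\dots,A_{2r+2}\}$ are graphs of permutations of $\{1,\dots,n+1\}$, i.e. sets of $n+1$ points of $\{1,\dots,n+1\}^2$ with pairwise distinct abscissas and pairwise distinct ordinates. Let $\mathcal C_n$ denote the set of convex permutominoes of size $n$. Boundary word and $\alpha$ points. Reading the boundary clockwise from $A_1$ gives a word over $\{N,E,S,W\}$ (unit north, east, south, west steps). Each occurrence of a factor $EN$ determines a reentrant point of type $\alpha$, namely the common point of the two steps. Active permutominoes and $\psi$. A convex permutomino $P$ of size $n$ is active if (1) its leftmost column contains exactly one cell, and (2) among its reentrant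 points of type $\alpha$, the one with the smallest abscissa has abscissa $2$, in the normalized coordinates above. Equivalently, the boundary word begins with $NEN$ and ends with $WW$. For an active $P$, let $\varrho$ be the row containing the unique cell of the leftmost column. $\psi(P)$ is the polyomino obtained from $P$ by deleting the cells of $\varrho$ and shifting every cell lying above $\varrho$ down by one unit. -}

module Defs where

open import Data.Nat using (ℕ; zero; suc; _+_; _≤_; _<_; _<?_)
open import Data.Bool using (Bool; true; false; _∨_)
open import Data.Fin using (Fin; zero; suc; toℕ; fromℕ<)
open import Data.Vec using (Vec; []; _∷_; lookup; map; tail; removeAt; insertAt; zipWith; _∷ʳ_)
open import Data.Maybe using (Maybe; just; nothing; fromMaybe)
open import Data.Product using (Σ; ∃; _×_; _,_)
open import Data.Sum using (_⊎_)
open import Data.Fin.Permutation using (Permutation′; _⟨$⟩ʳ_)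
open import Function.Bundles using (_⇔_)
open import Relation.Nullary using (yes; no)
open import Relation.Binary.PropositionalEquality using (_≡_)
open import Relation.Binary.Construct.Closure.ReflexiveTransitive using (Star)

-- A grid g : Grid n lists rows bottom-to-top (row index y = 0 is the
-- lowest row); each row lists columns left-to-right.  Cell (x , y)
-- (0-based) is the unit square [x+1 , x+2] × [y+1 , y+2] in the paper's
-- normalised coordinates (bounding square with bottom-left corner (1,1)).
-- Taking polyominoes up to translation = this normalised form (together
-- with the requirement that every row and column is non-empty).

Grid : ℕ → Set
Grid n = Vec (Vec Bool n) n

occ : ∀ {n} → Grid n → ℕ → ℕ → Bool
occ {n} g x y with x <? n | y <? n
... | yes p | yes q = lookup (lookup g (fromℕ< q)) (fromℕ< p)
... | _     | _     = false

occ′ : ∀ {n} → Grid n → ℕ → ℕ → Bool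
occ′ g (suc x) (suc y) = occ g x y
occ′ g _       _       = false

Occ : ∀ {n} → Grid n → ℕ × ℕ → Set
Occ g (x , y) = occ g x y ≡ true

RowsNonempty : ∀ {n} → Grid n → Set
RowsNonempty {n} g = ∀ y → y < n → ∃ λ x → Occ g (x , y)

ColsNonempty : ∀ {n} → Grid n → Set
ColsNonempty {n} g = ∀ x → x < n → ∃ λ y → Occ g (x , y)

Neighbour : ℕ × ℕ → ℕ × ℕ → Set
Neighbour (x , y) (x′ , y′) =
  (x ≡ x′ × (suc y ≡ y′ ⊎ y ≡ suc y′)) ⊎ (y ≡ y′ × (suc x ≡ x′ ⊎ x ≡ suc x′))

Step : ∀ {n} → Grid n → ℕ × ℕ → ℕ × ℕ → Set
Step g a b = Occ g a × Occ g b × Neighbour a b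

-- connected (as a union of cells, with no cut point) = any two cells are
-- joined by a path of edge-adjacent cells
Connected : ∀ {n} → Grid n → Set
Connected g = ∀ a b → Occ g a → Occ g b → Star (Step g) a b

RowConvex : ∀ {n} → Grid n → Set
RowConvex g = ∀ y x₁ x₂ x₃ → x₁ ≤ x₂ → x₂ ≤ x₃ →
  Occ g (x₁ , y) → Occ g (x₃ , y) → Occ g (x₂ , y)

ColConvex : ∀ {n} → Grid n → Set
ColConvex g = ∀ x y₁ y₂ y₃ → y₁ ≤ y₂ → y₂ ≤ y₃ →
  Occ g (x , y₁) → Occ g (x , y₃) → Occ g (x , y₂)

-- Boundary corners and their clockwise alternation.
-- Vertex (i , j) (0-based) is the lattice point (i+1 , j+1) of the paper.
-- Its four surrounding cells:

ne nw se sw : ∀ {n} → Grid n → ℕ → ℕ → Bool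
ne g i j = occ′ g (suc i) (suc j)
nw g i j = occ′ g i       (suc j)
se g i j = occ′ g (suc i) j
sw g i j = occ′ g i       j

b2n : Bool → ℕ
b2n true  = 1
b2n false = 0

diag anti : ∀ {n} → Grid n → ℕ → ℕ → ℕ
diag g i j = b2n (ne g i j) + b2n (sw g i j)
anti g i j = b2n (nw g i j) + b2n (se g i j)

-- For a hole-free polyomino without cut points, the corners are the
-- vertices with an odd number of surrounding cells; traversing the
-- boundary clockwise (interior on the right), the corners alternate
-- between those entered horizontally and left vertically (the class of
-- A₁, i.e. A₁, A₃, …) and those entered vertically and left horizontally
-- (A₂, A₄, …).  Locally, the first class is: single cell NE or SW, or
-- three cells with SE or NW missing; the second class is the rest.
OddCorner : ∀ {n} → Grid n → ℕ → ℕ → Set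
OddCorner g i j = diag g i j ≡ suc (anti g i j)

EvenCorner : ∀ {n} → Grid n → ℕ → ℕ → Set
EvenCorner g i j = anti g i j ≡ suc (diag g i j)

IsPermGraph : ∀ m → (Fin m → Fin m → Set) → Set
IsPermGraph m R = Σ (Permutation′ m) λ σ → ∀ i j → R i j ⇔ (j ≡ σ ⟨$⟩ʳ i)

ConvexPermutomino : ∀ n → Grid n → Set
ConvexPermutomino n g =
  RowsNonempty g × ColsNonempty g × Connected g ×
  RowConvex g × ColConvex g ×
  IsPermGraph (suc n) (λ i j → OddCorner g (toℕ i) (toℕ j)) ×
  IsPermGraph (suc n) (λ i j → EvenCorner g (toℕ i) (toℕ j))

-- reentrant point of type α (factor EN): NW cell missing, NE, SE, SW present
Alpha : ∀ {n} → Grid n → ℕ → ℕ → Set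
Alpha g i j = nw g i j ≡ false × ne g i j ≡ true × se g i j ≡ true × sw g i j ≡ true

Active : ∀ n → Grid n → Set
Active n g =
  ConvexPermutomino n g ×
  (∃ λ y → Occ g (0 , y) × (∀ y′ → Occ g (0 , y′) → y′ ≡ y)) ×
  -- (2) the α point of smallest abscissa has abscissa 2 (0-based vertex 1)
  ((∃ λ j → Alpha g 1 j) × (∀ i j → Alpha g i j → 1 ≤ i))

firstCol0 : ∀ {k c} → Vec (Vec Bool c) k → Maybe (Fin k)
firstCol0 [] = nothing
firstCol0 (([]) ∷ rs) = Data.Maybe.map suc (firstCol0 rs)
firstCol0 ((true ∷ _) ∷ rs) = just zero
firstCol0 ((false ∷ _) ∷ rs) = Data.Maybe.map suc (firstCol0 rs)

-- ψ: delete row ρ (the row of the unique leftmost-column cell), shift the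
-- rows above it down, and translate one unit to the left (the leftmost
-- column is then empty), i.e. drop column 0.
ψ : ∀ {m} → Grid (suc m) → Grid m
ψ g = map tail (removeAt g (fromMaybe zero (firstCol0 g)))

-- φ: ρ′ = row of the lowest cell of the leftmost column (the row containing
-- the leftmost boundary point of minimal ordinate).  Add a new empty
-- leftmost column, and insert immediately below ρ′ a new row which is ρ′
-- extended by one cell to the left, ending at the same abscissa.
φ : ∀ {m} → Grid m → Grid (suc m)
φ {m} g = insertAt (map (false ∷_) g) pos newRow
  where
  pos : Fin (suc m)
  pos with firstCol0 g
  ... | just y  = Data.Fin.inject₁ y
  ... | nothing = zero
  r : Vec Bool m
  r with firstCol0 g
  ... | just y  = lookup g y
  ... | nothing = Data.Vec.replicate m false
  newRow : Vec Bool (suc m)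
  newRow = zipWith _∨_ (false ∷ r) (r ∷ʳ false)

{-# OPTIONS --safe #-}
-- Both classes of corners are detected locally: a vertex is a corner of the class of A₁ or of
-- A₂ according to the parity pattern of its four surrounding cells.  Let G be active, with its
-- single leftmost cell in row ρ.  The α point at abscissa 2 puts cells at (1, ρ) and (1, ρ+1),
-- and rows ρ and ρ+1 then agree from column 1 on: at the first column where they differed,
-- the vertex at height ρ+1 would be a corner sharing its ordinate with a corner of the same
-- class in column 0 or 1.  So G arises from Q = ψ G by inserting a copy of row ρ extended one
-- cell to the left, which is what φ does; conversely φ Q has this shape for every convex
-- permutomino Q.  Under such an insertion cells, convexity and connectivity transfer directly,
-- and corners away from column 0 and row ρ keep their class; the only changes are the new even
-- corner (0, ρ+1) and the odd corner (0, ρ) of Q doubling into (0, ρ) and (1, ρ+1).  Each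
-- corner permutation of G is therefore a one-point extension of the one of Q.
module Submission where

open import Defs
open import Data.Bool using (Bool; true; false; _∨_)
open import Data.Bool.Properties using (¬-not)
open import Data.Fin using (Fin; zero; suc; toℕ; fromℕ<; inject₁; punchIn; punchOut)
open import Data.Fin.Permutation using (Permutation′; _⟨$⟩ʳ_; _⟨$⟩ˡ_; inverseˡ; insert; remove; insert-punchIn; punchIn-permute)
open import Data.Fin.Properties using (_≟_; toℕ-fromℕ<; toℕ-injective; toℕ-inject₁; punchIn-injective; punchInᵢ≢i; punchIn-punchOut)
open import Data.Maybe using (just; fromMaybe)
open import Data.Nat using (ℕ; zero; suc; _+_; pred; _≤_; _<_; _<?_; z≤n; s≤s; s≤s⁻¹) renaming (_≟_ to _≟ℕ_)
open import Data.Nat.Properties using (<⇒≢; pred-mono-≤; ≤-antisym; ≤-reflexive; +-comm; m≤n⇒m≤1+n; <-cmp; <-trans; ≤-trans; ≤-refl; n<1+n; n≤1+n; suc-injective; 1+n≢n)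
open import Data.Product using (∃; _×_; _,_; proj₁; proj₂)
import Data.Product as Product
open import Data.Product.Function.NonDependent.Propositional using (_×-⇔_)
open import Data.Sum using (_⊎_; inj₁; inj₂)
open import Data.Vec using (Vec; []; _∷_; lookup; map; tail; removeAt; insertAt; zipWith; _∷ʳ_)
open import Function using (id)
open import Function.Bundles using (_⇔_; mk⇔; Equivalence)
open import Relation.Binary using (tri<; tri≈; tri>)
import Relation.Binary.Construct.Closure.ReflexiveTransitive as Star
open Star using (Star; ε; _◅_; _◅◅_)
open import Relation.Binary.PropositionalEquality
open import Relation.Nullary using (¬_; yes; no; contradiction)

-- ℕ counterparts of Data.Fin's punchIn and pinch.
punchInℕ : ℕ → ℕ → ℕ
punchInℕ zero    y       = suc y
punchInℕ (suc p) zero    = zero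
punchInℕ (suc p) (suc y) = suc (punchInℕ p y)

pinchℕ : ℕ → ℕ → ℕ
pinchℕ _       zero    = zero
pinchℕ zero    (suc y) = y
pinchℕ (suc p) (suc y) = suc (pinchℕ p y)

data Punchedℕ (p : ℕ) : ℕ → Set where
  here  : Punchedℕ p p
  there : ∀ y → Punchedℕ p (punchInℕ p y)

punchedℕ : ∀ p y → Punchedℕ p y
punchedℕ zero    zero    = here
punchedℕ zero    (suc y) = there y
punchedℕ (suc p) zero    = there zero
punchedℕ (suc p) (suc y) with punchedℕ p y
... | here     = here
... | there y′ = there (suc y′)

punchInℕᵢ≢i : ∀ p y → punchInℕ p y ≢ p
punchInℕᵢ≢i (suc p) (suc y) e = punchInℕᵢ≢i p y (suc-injective e)

punchInℕ-< : ∀ {p y} → y < p → punchInℕ p y ≡ y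
punchInℕ-< {suc p} {zero}  _         = refl
punchInℕ-< {suc p} {suc y} (s≤s y<p) = cong suc (punchInℕ-< y<p)

punchInℕ-≥ : ∀ {p y} → p ≤ y → punchInℕ p y ≡ suc y
punchInℕ-≥ {zero}  {y}     _         = refl
punchInℕ-≥ {suc p} {suc y} (s≤s p≤y) = cong suc (punchInℕ-≥ p≤y)

punchInℕ-sucˡ : ∀ p {j} → j ≢ p → punchInℕ p j ≡ punchInℕ (suc p) j
punchInℕ-sucˡ zero    {zero}  j≢p = contradiction refl j≢p
punchInℕ-sucˡ zero    {suc j} _   = refl
punchInℕ-sucˡ (suc p) {zero}  _   = refl
punchInℕ-sucˡ (suc p) {suc j} j≢p = cong suc (punchInℕ-sucˡ p (λ e → j≢p (cong suc e)))

punchInℕ-sucˡ-≡ : ∀ p {j} → punchInℕ (suc p) j ≡ p → j ≡ p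
punchInℕ-sucˡ-≡ p {j} e with j ≟ℕ p
... | yes j≡p = j≡p
... | no j≢p  = contradiction (trans (punchInℕ-sucˡ p j≢p) e) (punchInℕᵢ≢i p j)

punchInℕ-sucʳ : ∀ p {y} → suc y ≢ p → punchInℕ p (suc y) ≡ suc (punchInℕ p y)
punchInℕ-sucʳ zero          _    = refl
punchInℕ-sucʳ (suc zero)    {zero}  y+1≢p = contradiction refl y+1≢p
punchInℕ-sucʳ (suc (suc p)) {zero}  _     = refl
punchInℕ-sucʳ (suc p)       {suc y} y+1≢p = cong suc (punchInℕ-sucʳ p (λ e → y+1≢p (cong suc e)))

punchInℕ-mono-≤ : ∀ p {y y′} → y ≤ y′ → punchInℕ p y ≤ punchInℕ p y′
punchInℕ-mono-≤ zero    y≤y′ = s≤s y≤y′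
punchInℕ-mono-≤ (suc p) {zero}  _           = z≤n
punchInℕ-mono-≤ (suc p) {suc y} (s≤s y≤y′) = s≤s (punchInℕ-mono-≤ p y≤y′)

punchInℕ≤suc : ∀ p y → punchInℕ p y ≤ suc y
punchInℕ≤suc zero    y       = ≤-refl
punchInℕ≤suc (suc p) zero    = z≤n
punchInℕ≤suc (suc p) (suc y) = s≤s (punchInℕ≤suc p y)

pinchℕ-mono-≤ : ∀ p {y y′} → y ≤ y′ → pinchℕ p y ≤ pinchℕ p y′
pinchℕ-mono-≤ p       {zero}            _           = z≤n
pinchℕ-mono-≤ zero    {suc y} {suc y′}  (s≤s y≤y′) = y≤y′
pinchℕ-mono-≤ (suc p) {suc y} {suc y′}  (s≤s y≤y′) = s≤s (pinchℕ-mono-≤ p y≤y′)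

pinchℕ< : ∀ p {y m} → y < suc m → p < m → pinchℕ p y < m
pinchℕ< zero    {zero}          _         p<m       = p<m
pinchℕ< zero    {suc y}         (s≤s y<m) _         = y<m
pinchℕ< (suc p) {zero}  {suc m} _         _         = s≤s z≤n
pinchℕ< (suc p) {suc y} {suc m} (s≤s y<m) (s≤s p<m) = s≤s (pinchℕ< p y<m p<m)

pinchℕ-punchInℕ : ∀ p y → pinchℕ p (punchInℕ p y) ≡ y
pinchℕ-punchInℕ zero    y       = refl
pinchℕ-punchInℕ (suc p) zero    = refl
pinchℕ-punchInℕ (suc p) (suc y) = cong suc (pinchℕ-punchInℕ p y)

pinchℕ-self : ∀ p → pinchℕ p p ≡ p
pinchℕ-self zero    = refl
pinchℕ-self (suc p) = cong suc (pinchℕ-self p)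

pinchℕ-suc-self : ∀ p → pinchℕ p (suc p) ≡ p
pinchℕ-suc-self zero    = refl
pinchℕ-suc-self (suc p) = cong suc (pinchℕ-suc-self p)

pinchℕ-suc : ∀ p {y} → y ≢ p → pinchℕ p (suc y) ≡ suc (pinchℕ p y)
pinchℕ-suc zero    {zero}  y≢p = contradiction refl y≢p
pinchℕ-suc zero    {suc y} _   = refl
pinchℕ-suc (suc p) {zero}  _   = refl
pinchℕ-suc (suc p) {suc y} y≢p = cong suc (pinchℕ-suc p (λ e → y≢p (cong suc e)))

punchInℕ-pinchℕ : ∀ p {y} → y ≢ p → punchInℕ p (pinchℕ p y) ≡ y
punchInℕ-pinchℕ p {y} y≢p with punchedℕ p y
... | here     = contradiction refl y≢p
... | there y′ = cong (punchInℕ p) (pinchℕ-punchInℕ p y′)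

entry : ∀ {c} → Vec Bool c → ℕ → Bool
entry []      _       = false
entry (b ∷ _) zero    = b
entry (_ ∷ v) (suc x) = entry v x

cell : ∀ {k c} → Vec (Vec Bool c) k → ℕ → ℕ → Bool
cell []       _ _       = false
cell (r ∷ _)  x zero    = entry r x
cell (_ ∷ rs) x (suc y) = cell rs x y

entry-fromℕ< : ∀ {c} (v : Vec Bool c) x .(p : x < c) → lookup v (fromℕ< p) ≡ entry v x
entry-fromℕ< (b ∷ v) zero    p = refl
entry-fromℕ< (b ∷ v) (suc x) p = entry-fromℕ< v x (s≤s⁻¹ p)

cell-fromℕ< : ∀ {k c} (g : Vec (Vec Bool c) k) x y .(q : y < k) → entry (lookup g (fromℕ< q)) x ≡ cell g x y
cell-fromℕ< (r ∷ g) x zero    q = refl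
cell-fromℕ< (r ∷ g) x (suc y) q = cell-fromℕ< g x y (s≤s⁻¹ q)

entry-outside : ∀ {c} (v : Vec Bool c) x → ¬ x < c → entry v x ≡ false
entry-outside []      x       _   = refl
entry-outside (b ∷ v) zero    x≮c = contradiction (s≤s z≤n) x≮c
entry-outside (b ∷ v) (suc x) x≮c = entry-outside v x (λ q → x≮c (s≤s q))

cell-outsideˣ : ∀ {k c} (g : Vec (Vec Bool c) k) x y → ¬ x < c → cell g x y ≡ false
cell-outsideˣ []      x y       _   = refl
cell-outsideˣ (r ∷ g) x zero    x≮c = entry-outside r x x≮c
cell-outsideˣ (r ∷ g) x (suc y) x≮c = cell-outsideˣ g x y x≮c

cell-outsideʸ : ∀ {k c} (g : Vec (Vec Bool c) k) x y → ¬ y < k → cell g x y ≡ false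
cell-outsideʸ []      x y       _   = refl
cell-outsideʸ (r ∷ g) x zero    y≮k = contradiction (s≤s z≤n) y≮k
cell-outsideʸ (r ∷ g) x (suc y) y≮k = cell-outsideʸ g x y (λ q → y≮k (s≤s q))

occ≡cell : ∀ {n} (g : Grid n) x y → occ g x y ≡ cell g x y
occ≡cell {n} g x y with x <? n | y <? n
... | yes p   | yes q   = trans (entry-fromℕ< (lookup g (fromℕ< q)) x p) (cell-fromℕ< g x y q)
... | no x≮n  | _       = sym (cell-outsideˣ g x y x≮n)
... | yes _   | no y≮n  = sym (cell-outsideʸ g x y y≮n)

occ-bounded : ∀ {n} (g : Grid n) {x y} → occ g x y ≡ true → x < n × y < n
occ-bounded {n} g {x} {y} o with x <? n | y <? n
... | yes p | yes q = p , q
occ-bounded g () | no _  | _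
occ-bounded g () | yes _ | no _

entry-ext : ∀ {c} (u v : Vec Bool c) → (∀ x → entry u x ≡ entry v x) → u ≡ v
entry-ext []      []      _ = refl
entry-ext (a ∷ u) (b ∷ v) e = cong₂ _∷_ (e zero) (entry-ext u v (λ x → e (suc x)))

cell-ext : ∀ {k c} (g h : Vec (Vec Bool c) k) → (∀ x y → cell g x y ≡ cell h x y) → g ≡ h
cell-ext []      []      _ = refl
cell-ext (r ∷ g) (s ∷ h) e = cong₂ _∷_ (entry-ext r s (λ x → e x zero)) (cell-ext g h (λ x y → e x (suc y)))

occ-ext : ∀ {n} (g h : Grid n) → (∀ x y → occ g x y ≡ occ h x y) → g ≡ h
occ-ext g h e = cell-ext g h λ x y → trans (sym (occ≡cell g x y)) (trans (e x y) (occ≡cell h x y))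

entry-lookup : ∀ {k c} (g : Vec (Vec Bool c) k) i x → entry (lookup g i) x ≡ cell g x (toℕ i)
entry-lookup (r ∷ g) zero    x = refl
entry-lookup (r ∷ g) (suc i) x = entry-lookup g i x

entry-zipWith-∨ : ∀ {c} (u v : Vec Bool c) x → entry (zipWith _∨_ u v) x ≡ entry u x ∨ entry v x
entry-zipWith-∨ []      []      x       = refl
entry-zipWith-∨ (a ∷ u) (b ∷ v) zero    = refl
entry-zipWith-∨ (a ∷ u) (b ∷ v) (suc x) = entry-zipWith-∨ u v x

entry-∷ʳ-false : ∀ {c} (u : Vec Bool c) x → entry (u ∷ʳ false) x ≡ entry u x
entry-∷ʳ-false []      zero    = refl
entry-∷ʳ-false []      (suc x) = refl
entry-∷ʳ-false (a ∷ u) zero    = refl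
entry-∷ʳ-false (a ∷ u) (suc x) = entry-∷ʳ-false u x

cell-map-tail : ∀ {k c} (g : Vec (Vec Bool (suc c)) k) x y → cell (map tail g) x y ≡ cell g (suc x) y
cell-map-tail []            x y       = refl
cell-map-tail ((b ∷ r) ∷ g) x zero    = refl
cell-map-tail (r ∷ g)       x (suc y) = cell-map-tail g x y

cell-map-false∷ : ∀ {k c} (g : Vec (Vec Bool c) k) x y → cell (map (false ∷_) g) (suc x) y ≡ cell g x y
cell-map-false∷ []      x y       = refl
cell-map-false∷ (r ∷ g) x zero    = refl
cell-map-false∷ (r ∷ g) x (suc y) = cell-map-false∷ g x y

cell-map-false∷-zero : ∀ {k c} (g : Vec (Vec Bool c) k) y → cell (map (false ∷_) g) zero y ≡ false
cell-map-false∷-zero []      y       = refl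
cell-map-false∷-zero (r ∷ g) zero    = refl
cell-map-false∷-zero (r ∷ g) (suc y) = cell-map-false∷-zero g y

cell-removeAt : ∀ {k c} (g : Vec (Vec Bool c) (suc k)) i x y → cell (removeAt g i) x y ≡ cell g x (punchInℕ (toℕ i) y)
cell-removeAt (r ∷ g)      zero    x y       = refl
cell-removeAt (r ∷ s ∷ g)  (suc i) x zero    = refl
cell-removeAt (r ∷ s ∷ g)  (suc i) x (suc y) = cell-removeAt (s ∷ g) i x y

cell-insertAt-punchIn : ∀ {k c} (g : Vec (Vec Bool c) k) i v x y →
                        cell (insertAt g i v) x (punchInℕ (toℕ i) y) ≡ cell g x y
cell-insertAt-punchIn g       zero    v x y       = refl
cell-insertAt-punchIn (r ∷ g) (suc i) v x zero    = refl
cell-insertAt-punchIn (r ∷ g) (suc i) v x (suc y) = cell-insertAt-punchIn g i v x y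
cell-insertAt-punchIn []      (suc ()) v x y

cell-insertAt : ∀ {k c} (g : Vec (Vec Bool c) k) i v x → cell (insertAt g i v) x (toℕ i) ≡ entry v x
cell-insertAt g       zero    v x = refl
cell-insertAt (r ∷ g) (suc i) v x = cell-insertAt g i v x

∨-redundantʳ : ∀ {a b} → (b ≡ true → a ≡ true) → a ∨ b ≡ a
∨-redundantʳ {true}          _   = refl
∨-redundantʳ {false} {false} _   = refl
∨-redundantʳ {false} {true}  b⇒a = sym (b⇒a refl)

firstCol0-sound : ∀ {k c} (g : Vec (Vec Bool c) k) {i} → firstCol0 g ≡ just i →
                  cell g 0 (toℕ i) ≡ true × (∀ y → y < toℕ i → cell g 0 y ≡ false)
firstCol0-sound ((true ∷ r) ∷ rs) {zero} refl = refl , λ _ ()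
firstCol0-sound ([] ∷ rs) eq with firstCol0 rs in e
firstCol0-sound ([] ∷ rs) refl | just i with firstCol0-sound rs e
... | top , below = top , λ { zero _ → refl ; (suc y) (s≤s y<i) → below y y<i }
firstCol0-sound ((false ∷ r) ∷ rs) eq with firstCol0 rs in e
firstCol0-sound ((false ∷ r) ∷ rs) refl | just i with firstCol0-sound rs e
... | top , below = top , λ { zero _ → refl ; (suc y) (s≤s y<i) → below y y<i }

firstCol0-complete : ∀ {k c} (g : Vec (Vec Bool c) k) y → cell g 0 y ≡ true → ∃ λ i → firstCol0 g ≡ just i
firstCol0-complete ((true ∷ r) ∷ rs)  y       o = zero , refl
firstCol0-complete ((false ∷ r) ∷ rs) (suc y) o with firstCol0-complete rs y o
... | i , e rewrite e = suc i , refl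
firstCol0-complete ([] ∷ rs)          (suc y) o with firstCol0-complete rs y o
... | i , e rewrite e = suc i , refl

LowestInColumn₀ : ∀ {n} → Grid n → ℕ → Set
LowestInColumn₀ g ρ = Occ g (0 , ρ) × (∀ y → y < ρ → occ g 0 y ≡ false)

lowestInColumn₀-unique : ∀ {n} {g : Grid n} {ρ ρ′} →
                         LowestInColumn₀ g ρ → LowestInColumn₀ g ρ′ → ρ ≡ ρ′
lowestInColumn₀-unique {ρ = ρ} {ρ′} (top , below) (top′ , below′) with <-cmp ρ ρ′
... | tri< ρ<ρ′ _ _ = contradiction (trans (sym top) (below′ ρ ρ<ρ′)) λ ()
... | tri≈ _ e _    = e
... | tri> _ _ ρ′<ρ = contradiction (trans (sym top′) (below ρ′ ρ′<ρ)) λ ()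

firstCol0-lowestInColumn₀ : ∀ {n} (g : Grid n) {i} → firstCol0 g ≡ just i → LowestInColumn₀ g (toℕ i)
firstCol0-lowestInColumn₀ g eq with firstCol0-sound g eq
... | top , below = trans (occ≡cell g 0 _) top , λ y y<i → trans (occ≡cell g 0 y) (below y y<i)

lowestInColumn₀-exists : ∀ {n} (g : Grid n) {y} → Occ g (0 , y) → ∃ (LowestInColumn₀ g)
lowestInColumn₀-exists g {y} o with firstCol0-complete g y (trans (sym (occ≡cell g 0 y)) o)
... | i , eq = toℕ i , firstCol0-lowestInColumn₀ g eq

firstCol0-lowest : ∀ {n} (g : Grid n) {ρ} → LowestInColumn₀ g ρ → ∃ λ i → firstCol0 g ≡ just i × toℕ i ≡ ρ
firstCol0-lowest g low@(top , _) with firstCol0-complete g _ (trans (sym (occ≡cell g 0 _)) top)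
... | i , eq = i , eq , lowestInColumn₀-unique {g = g} (firstCol0-lowestInColumn₀ g eq) low

ψ-occ : ∀ {m} (g : Grid (suc m)) {ρ} → LowestInColumn₀ g ρ →
        ∀ x y → occ (ψ g) x y ≡ occ g (suc x) (punchInℕ ρ y)
ψ-occ g low x y with firstCol0-lowest g low
... | i , eq , refl = begin
  occ (ψ g) x y                                   ≡⟨ occ≡cell (ψ g) x y ⟩
  cell (map tail (removeAt g (fromMaybe zero (firstCol0 g)))) x y
    ≡⟨ cong (λ z → cell (map tail (removeAt g (fromMaybe zero z))) x y) eq ⟩
  cell (map tail (removeAt g i)) x y              ≡⟨ cell-map-tail (removeAt g i) x y ⟩
  cell (removeAt g i) (suc x) y                   ≡⟨ cell-removeAt g i (suc x) y ⟩
  cell g (suc x) (punchInℕ (toℕ i) y)             ≡⟨ sym (occ≡cell g _ _) ⟩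
  occ g (suc x) (punchInℕ (toℕ i) y)              ∎
  where open ≡-Reasoning

φ-unfold : ∀ {m} (g : Grid m) {k} → firstCol0 g ≡ just k →
  φ g ≡ insertAt (map (false ∷_) g) (inject₁ k) (zipWith _∨_ (false ∷ lookup g k) (lookup g k ∷ʳ false))
φ-unfold g eq with firstCol0 g
φ-unfold g refl | just _ = refl

private
  module φ-at {m} (g : Grid m) {k} (eq : firstCol0 g ≡ just k) where
    row : Vec Bool m
    row = lookup g k

    new : Vec Bool (suc m)
    new = zipWith _∨_ (false ∷ row) (row ∷ʳ false)

    φ′ : Grid (suc m)
    φ′ = insertAt (map (false ∷_) g) (inject₁ k) new

    occ-φ : ∀ x y → occ (φ g) x y ≡ cell φ′ x y
    occ-φ x y = trans (occ≡cell (φ g) x y) (cong (λ h → cell h x y) (φ-unfold g eq))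

    occ-φ-punchIn : ∀ x y → occ (φ g) x (punchInℕ (toℕ k) y) ≡ cell (map (false ∷_) g) x y
    occ-φ-punchIn x y = trans (occ-φ x _)
      (subst (λ t → cell φ′ x (punchInℕ t y) ≡ _) (toℕ-inject₁ k) (cell-insertAt-punchIn _ (inject₁ k) new x y))

    entry-row : ∀ x → entry row x ≡ occ g x (toℕ k)
    entry-row x = trans (entry-lookup g k x) (sym (occ≡cell g x _))

    occ-φ-row : ∀ x → occ (φ g) x (toℕ k) ≡ entry (false ∷ row) x ∨ occ g x (toℕ k)
    occ-φ-row x = begin
      occ (φ g) x (toℕ k)                          ≡⟨ occ-φ x _ ⟩
      cell φ′ x (toℕ k)                            ≡⟨ cong (cell φ′ x) (sym (toℕ-inject₁ k)) ⟩
      cell φ′ x (toℕ (inject₁ k))                  ≡⟨ cell-insertAt _ (inject₁ k) new x ⟩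
      entry new x                                  ≡⟨ entry-zipWith-∨ (false ∷ row) (row ∷ʳ false) x ⟩
      entry (false ∷ row) x ∨ entry (row ∷ʳ false) x
        ≡⟨ cong (entry (false ∷ row) x ∨_) (trans (entry-∷ʳ-false row x) (entry-row x)) ⟩
      entry (false ∷ row) x ∨ occ g x (toℕ k)      ∎
      where open ≡-Reasoning

module _ {m} (g : Grid m) {ρ} (low : LowestInColumn₀ g ρ) where

  φ-occ-zero-punchIn : ∀ y → occ (φ g) 0 (punchInℕ ρ y) ≡ false
  φ-occ-zero-punchIn y with firstCol0-lowest g low
  ... | k , eq , refl = trans (φ-at.occ-φ-punchIn g eq 0 y) (cell-map-false∷-zero g y)

  φ-occ-suc-punchIn : ∀ x y → occ (φ g) (suc x) (punchInℕ ρ y) ≡ occ g x y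
  φ-occ-suc-punchIn x y with firstCol0-lowest g low
  ... | k , eq , refl = trans (φ-at.occ-φ-punchIn g eq (suc x) y) (trans (cell-map-false∷ g x y) (sym (occ≡cell g x y)))

  φ-occ-zero-ρ : occ (φ g) 0 ρ ≡ true
  φ-occ-zero-ρ with firstCol0-lowest g low
  ... | k , eq , refl = trans (φ-at.occ-φ-row g eq 0) (proj₁ low)

  φ-occ-suc-ρ : ∀ x → occ (φ g) (suc x) ρ ≡ occ g x ρ ∨ occ g (suc x) ρ
  φ-occ-suc-ρ x with firstCol0-lowest g low
  ... | k , eq , refl = trans (φ-at.occ-φ-row g eq (suc x)) (cong (_∨ occ g (suc x) (toℕ k)) (φ-at.entry-row g eq x))

-- Permutation graphs

toℕ-punchIn : ∀ {n} (i : Fin (suc n)) (j : Fin n) → toℕ (punchIn i j) ≡ punchInℕ (toℕ i) (toℕ j)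
toℕ-punchIn zero    j       = refl
toℕ-punchIn (suc i) zero    = refl
toℕ-punchIn (suc i) (suc j) = cong suc (toℕ-punchIn i j)

data Punched {n} (a : Fin (suc n)) : Fin (suc n) → Set where
  here  : Punched a a
  there : ∀ i → Punched a (punchIn a i)

punched : ∀ {n} (a x : Fin (suc n)) → Punched a x
punched a x with a ≟ x
... | yes refl = here
... | no a≢x   = subst (Punched a) (punchIn-punchOut a≢x) (there (punchOut a≢x))

insert-self : ∀ {m n} (i : Fin (suc m)) (j : Fin (suc n)) π → insert i j π ⟨$⟩ʳ i ≡ j
insert-self i j π with i ≟ i
... | yes _  = refl
... | no i≢i = contradiction refl i≢i

module OnePointExtension {K} (R : Fin (suc K) → Fin (suc K) → Set) (R′ : Fin K → Fin K → Set)
  (a c : Fin (suc K)) (row-a : ∀ y → R a y → y ≡ c)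
  (rest : ∀ i j → R (punchIn a i) (punchIn c j) ⇔ R′ i j) where
  open Equivalence

  isPermGraph-remove : IsPermGraph (suc K) R → IsPermGraph K R′
  isPermGraph-remove (σ , graph) = remove a σ , λ i j → mk⇔ (to′ i j) (from′ i j)
    where
    σ-punchIn : ∀ i → σ ⟨$⟩ʳ punchIn a i ≡ punchIn c (remove a σ ⟨$⟩ʳ i)
    σ-punchIn i = trans (punchIn-permute σ a i)
      (cong (λ z → punchIn z (remove a σ ⟨$⟩ʳ i)) (row-a _ (from (graph a _) refl)))
    to′ : ∀ i j → R′ i j → j ≡ remove a σ ⟨$⟩ʳ i
    to′ i j r = punchIn-injective c _ _ (trans (to (graph _ _) (from (rest i j) r)) (σ-punchIn i))
    from′ : ∀ i j → j ≡ remove a σ ⟨$⟩ʳ i → R′ i j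
    from′ i j refl = to (rest i j) (from (graph _ _) (sym (σ-punchIn i)))

  isPermGraph-insert : R a c → (∀ x → R x c → x ≡ a) → IsPermGraph K R′ → IsPermGraph (suc K) R
  isPermGraph-insert a-c col-c (σ′ , graph′) = τ , graph
    where
    τ : Permutation′ (suc K)
    τ = insert a c σ′
    graph : ∀ x y → R x y ⇔ (y ≡ τ ⟨$⟩ʳ x)
    graph x y with punched a x | punched c y
    ... | here    | _       = subst (λ t → R a y ⇔ (y ≡ t)) (sym (insert-self a c σ′))
                                  (mk⇔ (row-a y) λ { refl → a-c })
    ... | there i | here    = mk⇔ (λ r → contradiction (col-c _ r) (punchInᵢ≢i a i))
                                   (λ e → contradiction (sym (trans e (insert-punchIn a c σ′ i))) (punchInᵢ≢i c _))
    ... | there i | there j = mk⇔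
      (λ r → trans (cong (punchIn c) (to (graph′ i j) (to (rest i j) r))) (sym (insert-punchIn a c σ′ i)))
      (λ e → from (rest i j) (from (graph′ i j) (punchIn-injective c _ _ (trans e (insert-punchIn a c σ′ i)))))

PermGraphℕ : ℕ → (ℕ → ℕ → Set) → Set
PermGraphℕ n R = IsPermGraph n (λ i j → R (toℕ i) (toℕ j))

module _ {n} {R : ℕ → ℕ → Set} (bounded : ∀ {i j} → R i j → i < n × j < n) (graph : PermGraphℕ n R) where
  private
    σ : Permutation′ n
    σ = proj₁ graph

    σ-fromℕ< : ∀ {i j} (r : R i j) → fromℕ< (proj₂ (bounded r)) ≡ σ ⟨$⟩ʳ fromℕ< (proj₁ (bounded r))
    σ-fromℕ< r = Equivalence.to (proj₂ graph _ _)
      (subst₂ R (sym (toℕ-fromℕ< (proj₁ (bounded r)))) (sym (toℕ-fromℕ< (proj₂ (bounded r)))) r)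

  permGraphℕ-functional : ∀ {i j j′} → R i j → R i j′ → j ≡ j′
  permGraphℕ-functional r r′ = begin
    _                                       ≡⟨ sym (toℕ-fromℕ< (proj₂ (bounded r))) ⟩
    toℕ (fromℕ< (proj₂ (bounded r)))        ≡⟨ cong toℕ (trans (σ-fromℕ< r) (sym (σ-fromℕ< r′))) ⟩
    toℕ (fromℕ< (proj₂ (bounded r′)))       ≡⟨ toℕ-fromℕ< (proj₂ (bounded r′)) ⟩
    _                                       ∎
    where open ≡-Reasoning

  permGraphℕ-injective : ∀ {i i′ j} → R i j → R i′ j → i ≡ i′
  permGraphℕ-injective r r′ = begin
    _                                       ≡⟨ sym (toℕ-fromℕ< (proj₁ (bounded r))) ⟩
    toℕ (fromℕ< (proj₁ (bounded r)))        ≡⟨ cong toℕ (σ-injective (trans (sym (σ-fromℕ< r)) (σ-fromℕ< r′))) ⟩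
    toℕ (fromℕ< (proj₁ (bounded r′)))       ≡⟨ toℕ-fromℕ< (proj₁ (bounded r′)) ⟩
    _                                       ∎
    where
    open ≡-Reasoning
    σ-injective : ∀ {x y} → σ ⟨$⟩ʳ x ≡ σ ⟨$⟩ʳ y → x ≡ y
    σ-injective e = trans (sym (inverseˡ σ)) (trans (cong (σ ⟨$⟩ˡ_) e) (inverseˡ σ))

module _ {K} (R R′ : ℕ → ℕ → Set) {a c} (a<1+K : a < suc K) (c<1+K : c < suc K)
  (row-a : ∀ y → R a y → y ≡ c)
  (rest : ∀ i j → R (punchInℕ a i) (punchInℕ c j) ⇔ R′ i j) where
  private
    toℕ-punchIn-fromℕ< : ∀ {p} (p<1+K : p < suc K) i → toℕ (punchIn (fromℕ< p<1+K) i) ≡ punchInℕ p (toℕ i)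
    toℕ-punchIn-fromℕ< p<1+K i = trans (toℕ-punchIn _ i) (cong (λ t → punchInℕ t (toℕ i)) (toℕ-fromℕ< p<1+K))

    at-a : ∀ {y} → R (toℕ (fromℕ< a<1+K)) y → R a y
    at-a = subst (λ t → R t _) (toℕ-fromℕ< a<1+K)

    at-c : ∀ {x} → R x (toℕ (fromℕ< c<1+K)) → R x c
    at-c = subst (R _) (toℕ-fromℕ< c<1+K)

    toFin : ∀ {p} (p<1+K : p < suc K) {x} → toℕ x ≡ p → x ≡ fromℕ< p<1+K
    toFin p<1+K e = toℕ-injective (trans e (sym (toℕ-fromℕ< p<1+K)))

    module E = OnePointExtension (λ x y → R (toℕ x) (toℕ y)) (λ i j → R′ (toℕ i) (toℕ j))
      (fromℕ< a<1+K) (fromℕ< c<1+K)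
      (λ y r → toFin c<1+K (row-a _ (at-a r)))
      (λ i j → subst₂ (λ u v → R u v ⇔ R′ (toℕ i) (toℕ j))
        (sym (toℕ-punchIn-fromℕ< a<1+K i)) (sym (toℕ-punchIn-fromℕ< c<1+K j)) (rest (toℕ i) (toℕ j)))

  permGraphℕ-remove : PermGraphℕ (suc K) R → PermGraphℕ K R′
  permGraphℕ-remove = E.isPermGraph-remove

  permGraphℕ-insert : R a c → (∀ x → R x c → x ≡ a) → PermGraphℕ K R′ → PermGraphℕ (suc K) R
  permGraphℕ-insert a-c col-c = E.isPermGraph-insert
    (subst₂ R (sym (toℕ-fromℕ< a<1+K)) (sym (toℕ-fromℕ< c<1+K)) a-c)
    (λ x r → toFin a<1+K (col-c _ (at-c r)))

-- Corners

OddQuad EvenQuad : Bool → Bool → Bool → Bool → Set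
OddQuad  ne sw nw se = b2n ne + b2n sw ≡ suc (b2n nw + b2n se)
EvenQuad ne sw nw se = b2n nw + b2n se ≡ suc (b2n ne + b2n sw)

quad-⇔ : ∀ {a b c d a′ b′ c′ d′} → a ≡ a′ → b ≡ b′ → c ≡ c′ → d ≡ d′ →
         (OddQuad a b c d ⇔ OddQuad a′ b′ c′ d′) × (EvenQuad a b c d ⇔ EvenQuad a′ b′ c′ d′)
quad-⇔ refl refl refl refl = mk⇔ id id , mk⇔ id id

cornerQuads : ∀ {n} (g : Grid n) i j {a b c d} →
  ne g i j ≡ a → sw g i j ≡ b → nw g i j ≡ c → se g i j ≡ d →
  (OddCorner g i j ⇔ OddQuad a b c d) × (EvenCorner g i j ⇔ EvenQuad a b c d)
cornerQuads g i j refl refl refl refl = mk⇔ id id , mk⇔ id id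

twin-¬oddQuad : ∀ a b → ¬ OddQuad a b b a
twin-¬oddQuad a b e = 1+n≢n (sym (trans e (cong suc (+-comm (b2n b) (b2n a)))))

twin-¬evenQuad : ∀ a b → ¬ EvenQuad a b b a
twin-¬evenQuad a b e = 1+n≢n (sym (trans e (cong suc (+-comm (b2n a) (b2n b)))))

b2n-+-suc : ∀ a b {k} → b2n a + b2n b ≡ suc k → a ≡ true ⊎ b ≡ true
b2n-+-suc true  _     _ = inj₁ refl
b2n-+-suc false true  _ = inj₂ refl

occ′-bounded : ∀ {n} (g : Grid n) x y → occ′ g x y ≡ true → x ≤ n × y ≤ n
occ′-bounded g (suc x) (suc y) o = occ-bounded g o

occ′-below : ∀ {n} (g : Grid n) x y →
             (∀ {y′} → suc y′ ≡ y → occ g x y′ ≡ false) → occ′ g (suc x) y ≡ false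
occ′-below g x zero    _ = refl
occ′-below g x (suc y) h = h refl

oddCorner-bounded : ∀ {n} (g : Grid n) {i j} → OddCorner g i j → i < suc n × j < suc n
oddCorner-bounded g {i} {j} c with b2n-+-suc (ne g i j) (sw g i j) c
... | inj₁ o = Product.map m≤n⇒m≤1+n m≤n⇒m≤1+n (occ′-bounded g (suc i) (suc j) o)
... | inj₂ o = Product.map s≤s s≤s (occ′-bounded g i j o)

evenCorner-bounded : ∀ {n} (g : Grid n) {i j} → EvenCorner g i j → i < suc n × j < suc n
evenCorner-bounded g {i} {j} c with b2n-+-suc (nw g i j) (se g i j) c
... | inj₁ o = Product.map s≤s m≤n⇒m≤1+n (occ′-bounded g i (suc j) o)
... | inj₂ o = Product.map m≤n⇒m≤1+n s≤s (occ′-bounded g (suc i) j o)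

module _ {n} {g : Grid n} where

  colsNonempty : ConvexPermutomino n g → ColsNonempty g
  colsNonempty (_ , cols , _) = cols

  rowConvex : ConvexPermutomino n g → RowConvex g
  rowConvex (_ , _ , _ , row-convex , _) = row-convex

  oddCorners : ConvexPermutomino n g → PermGraphℕ (suc n) (OddCorner g)
  oddCorners (_ , _ , _ , _ , _ , odd , _) = odd

  evenCorners : ConvexPermutomino n g → PermGraphℕ (suc n) (EvenCorner g)
  evenCorners (_ , _ , _ , _ , _ , _ , even) = even

module _ {n} {g : Grid n} (cp : ConvexPermutomino n g) where

  oddCorner-functional : ∀ {i j j′} → OddCorner g i j → OddCorner g i j′ → j ≡ j′
  oddCorner-functional = permGraphℕ-functional (oddCorner-bounded g) (oddCorners cp)

  oddCorner-injective : ∀ {i i′ j} → OddCorner g i j → OddCorner g i′ j → i ≡ i′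
  oddCorner-injective = permGraphℕ-injective (oddCorner-bounded g) (oddCorners cp)

  evenCorner-injective : ∀ {i i′ j} → EvenCorner g i j → EvenCorner g i′ j → i ≡ i′
  evenCorner-injective = permGraphℕ-injective (evenCorner-bounded g) (evenCorners cp)

-- Paths of cells

Step-sym : ∀ {n} {g : Grid n} {a b} → Step g a b → Step g b a
Step-sym (oa , ob , inj₁ (e , inj₁ s)) = ob , oa , inj₁ (sym e , inj₂ (sym s))
Step-sym (oa , ob , inj₁ (e , inj₂ s)) = ob , oa , inj₁ (sym e , inj₁ (sym s))
Step-sym (oa , ob , inj₂ (e , inj₁ s)) = ob , oa , inj₂ (sym e , inj₂ (sym s))
Step-sym (oa , ob , inj₂ (e , inj₂ s)) = ob , oa , inj₂ (sym e , inj₁ (sym s))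

Path : ∀ {n} → Grid n → ℕ × ℕ → ℕ × ℕ → Set
Path g = Star (Step g)

Path-reverse : ∀ {n} {g : Grid n} {a b} → Path g a b → Path g b a
Path-reverse {g = g} = Star.reverse (Step-sym {g = g})

module _ {n n′} {g : Grid n} {h : Grid n′} (f : ℕ × ℕ → ℕ × ℕ)
  (up    : ∀ {x y} → Occ g (x , y) → Occ g (x , suc y) → Path h (f (x , y)) (f (x , suc y)))
  (right : ∀ {x y} → Occ g (x , y) → Occ g (suc x , y) → Path h (f (x , y)) (f (suc x , y)))
  (reach : ∀ a → Occ h a → ∃ λ b → Occ g b × Path h a (f b)) where

  Path-map : ∀ {a b} → Path g a b → Path h (f a) (f b)
  Path-map = Star.kleisliStar f step
    where
    step : ∀ {a b} → Step g a b → Path h (f a) (f b)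
    step (oa , ob , inj₁ (refl , inj₁ refl)) = up oa ob
    step (oa , ob , inj₁ (refl , inj₂ refl)) = Path-reverse {g = h} (up ob oa)
    step (oa , ob , inj₂ (refl , inj₁ refl)) = right oa ob
    step (oa , ob , inj₂ (refl , inj₂ refl)) = Path-reverse {g = h} (right ob oa)

  connected-transfer : Connected g → Connected h
  connected-transfer conn a b oa ob with reach a oa | reach b ob
  ... | a′ , oa′ , a→a′ | b′ , ob′ , b→b′ =
    a→a′ ◅◅ Path-map (conn a′ b′ oa′ ob′) ◅◅ Path-reverse {g = h} b→b′

-- Row insertion

-- G is Q with a row inserted at index ρ that repeats row ρ of Q and reaches one cell further
-- left, into a new leftmost column holding only that cell.
record RowInsertion {m} (G : Grid (suc m)) (Q : Grid m) (ρ : ℕ) : Set where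
  field
    cells         : ∀ x y → occ Q x y ≡ occ G (suc x) (punchInℕ ρ y)
    ρ<m           : ρ < m
    column₀       : ∀ y → Occ G (0 , y) → y ≡ ρ
    column₀-ρ     : Occ G (0 , ρ)
    twin-rows     : ∀ x → occ G (suc x) ρ ≡ occ G (suc x) (suc ρ)
    column₁-ρ     : Occ G (1 , ρ)
    column₁-below : ∀ y → y < ρ → occ G 1 y ≡ false

module RowInsertionProperties {m} {G : Grid (suc m)} {Q : Grid m} {ρ} (I : RowInsertion G Q ρ) where
  open RowInsertion I
  open Equivalence

  column₀-false : ∀ {y} → y ≢ ρ → occ G 0 y ≡ false
  column₀-false y≢ρ = ¬-not (λ o → y≢ρ (column₀ _ o))

  column₁-suc-ρ : Occ G (1 , suc ρ)
  column₁-suc-ρ = trans (sym (twin-rows 0)) column₁-ρ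

  cells-pinch : ∀ x y → occ G (suc x) y ≡ occ Q x (pinchℕ ρ y)
  cells-pinch x y with punchedℕ ρ y
  ... | here = begin
    occ G (suc x) ρ                     ≡⟨ twin-rows x ⟩
    occ G (suc x) (suc ρ)               ≡⟨ cong (occ G (suc x)) (sym (punchInℕ-≥ ≤-refl)) ⟩
    occ G (suc x) (punchInℕ ρ ρ)        ≡⟨ sym (cells x ρ) ⟩
    occ Q x ρ                           ≡⟨ cong (occ Q x) (sym (pinchℕ-self ρ)) ⟩
    occ Q x (pinchℕ ρ ρ)                ∎
    where open ≡-Reasoning
  ... | there y′ = trans (sym (cells x y′)) (cong (occ Q x) (sym (pinchℕ-punchInℕ ρ y′)))

  -- Rows ρ and ρ+1 of G are twins, so either can serve as the image of row ρ of Q.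
  cells-punchIn-suc : ∀ x j → occ Q x j ≡ occ G (suc x) (punchInℕ (suc ρ) j)
  cells-punchIn-suc x j with j ≟ℕ ρ
  ... | no j≢ρ  = trans (cells x j) (cong (occ G (suc x)) (punchInℕ-sucˡ ρ j≢ρ))
  ... | yes refl = begin
    occ Q x ρ                           ≡⟨ cells x ρ ⟩
    occ G (suc x) (punchInℕ ρ ρ)        ≡⟨ cong (occ G (suc x)) (punchInℕ-≥ ≤-refl) ⟩
    occ G (suc x) (suc ρ)               ≡⟨ sym (twin-rows x) ⟩
    occ G (suc x) ρ                     ≡⟨ cong (occ G (suc x)) (sym (punchInℕ-< (n<1+n ρ))) ⟩
    occ G (suc x) (punchInℕ (suc ρ) ρ)  ∎
    where open ≡-Reasoning

  cells-ρ : ∀ x → occ Q x ρ ≡ occ G (suc x) ρ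
  cells-ρ x = trans (cells-punchIn-suc x ρ) (cong (occ G (suc x)) (punchInℕ-< (n<1+n ρ)))

  corner-⇔ : ∀ i j → ¬ (i ≡ 0 × j ≡ ρ) →
    (OddCorner G (suc i) (punchInℕ (suc ρ) j) ⇔ OddCorner Q i j) ×
    (EvenCorner G (suc i) (punchInℕ (suc ρ) j) ⇔ EvenCorner Q i j)
  corner-⇔ i j not-0ρ = quad-⇔ (sym (cells-punchIn-suc i j)) (sw-≡ i j) (nw-≡ i j not-0ρ) (se-≡ i j)
    where
    nw-≡ : ∀ i j → ¬ (i ≡ 0 × j ≡ ρ) → nw G (suc i) (punchInℕ (suc ρ) j) ≡ nw Q i j
    nw-≡ zero    j not-0ρ = column₀-false (λ e → not-0ρ (refl , punchInℕ-sucˡ-≡ ρ e))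
    nw-≡ (suc x) j _      = sym (cells-punchIn-suc x j)
    se-≡ : ∀ i j → se G (suc i) (punchInℕ (suc ρ) j) ≡ se Q i j
    se-≡ i zero    = refl
    se-≡ i (suc y) = sym (cells i y)
    sw-≡ : ∀ i j → sw G (suc i) (punchInℕ (suc ρ) j) ≡ sw Q i j
    sw-≡ zero    zero    = refl
    sw-≡ (suc x) zero    = refl
    sw-≡ zero    (suc y) = column₀-false (punchInℕᵢ≢i ρ y)
    sw-≡ (suc x) (suc y) = sym (cells x y)

  private
    y<ρ : ∀ {y} → suc y ≡ ρ → y < ρ
    y<ρ = ≤-reflexive

    se-column₀ : se G 0 ρ ≡ false
    se-column₀ = occ′-below G 0 ρ λ e → column₀-false (λ y≡ρ → 1+n≢n (trans e (sym y≡ρ)))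

    se-column₁ : se G 1 ρ ≡ false
    se-column₁ = occ′-below G 1 ρ λ e → column₁-below _ (y<ρ e)

    se-Q : se Q 0 ρ ≡ false
    se-Q = occ′-below Q 0 ρ λ e →
      trans (cells 0 _) (trans (cong (occ G 1) (punchInℕ-< (y<ρ e))) (column₁-below _ (y<ρ e)))

    Q₀-ρ : Occ Q (0 , ρ)
    Q₀-ρ = trans (cells-ρ 0) column₁-ρ

    column₀-suc-ρ : occ G 0 (suc ρ) ≡ false
    column₀-suc-ρ = column₀-false 1+n≢n

    oddCorner₀ : ∀ y → OddCorner G 0 y → y ≡ ρ
    oddCorner₀ y o with y ≟ℕ ρ
    ... | yes y≡ρ = y≡ρ
    ... | no y≢ρ  = contradiction (to (proj₁ (cornerQuads G 0 y (column₀-false y≢ρ) refl refl refl)) o) λ ()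

    oddCorner₀-ρ : OddCorner G 0 ρ
    oddCorner₀-ρ = from (proj₁ (cornerQuads G 0 ρ column₀-ρ refl refl se-column₀)) refl

    oddCorner₁-suc-ρ : OddCorner G 1 (suc ρ)
    oddCorner₁-suc-ρ =
      from (proj₁ (cornerQuads G 1 (suc ρ) column₁-suc-ρ column₀-ρ column₀-suc-ρ column₁-ρ)) refl

    oddCorner-suc-ρ : ∀ x → OddCorner G x (suc ρ) → x ≡ 1
    oddCorner-suc-ρ zero          o =
      contradiction (to (proj₁ (cornerQuads G 0 (suc ρ) column₀-suc-ρ refl refl refl)) o) λ ()
    oddCorner-suc-ρ (suc zero)    o = refl
    oddCorner-suc-ρ (suc (suc x)) o = contradiction
      (to (proj₁ (cornerQuads G (suc (suc x)) (suc ρ) refl (twin-rows x) refl (twin-rows (suc x)))) o)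
      (twin-¬oddQuad (occ G (suc (suc x)) (suc ρ)) (occ G (suc x) (suc ρ)))

    ¬oddCorner₁-ρ : ¬ OddCorner G 1 ρ
    ¬oddCorner₁-ρ o =
      contradiction (to (proj₁ (cornerQuads G 1 ρ column₁-ρ se-column₀ column₀-ρ se-column₁)) o) λ ()

    oddCornerQ₀-ρ : OddCorner Q 0 ρ
    oddCornerQ₀-ρ = from (proj₁ (cornerQuads Q 0 ρ Q₀-ρ refl refl se-Q)) refl

    evenCorner₀ : ∀ y → EvenCorner G 0 y → y ≡ suc ρ
    evenCorner₀ zero    e = contradiction (to (proj₂ (cornerQuads G 0 0 refl refl refl refl)) e) λ ()
    evenCorner₀ (suc y) e with y ≟ℕ ρ
    ... | yes y≡ρ = cong suc y≡ρ
    ... | no y≢ρ  = contradiction (to (proj₂ (cornerQuads G 0 (suc y) refl refl refl (column₀-false y≢ρ))) e) λ ()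

    evenCorner₀-suc-ρ : EvenCorner G 0 (suc ρ)
    evenCorner₀-suc-ρ = from (proj₂ (cornerQuads G 0 (suc ρ) column₀-suc-ρ refl refl column₀-ρ)) refl

    evenCorner-suc-ρ : ∀ x → EvenCorner G x (suc ρ) → x ≡ 0
    evenCorner-suc-ρ zero          e = refl
    evenCorner-suc-ρ (suc zero)    e = contradiction
      (to (proj₂ (cornerQuads G 1 (suc ρ) column₁-suc-ρ column₀-ρ column₀-suc-ρ column₁-ρ)) e) λ ()
    evenCorner-suc-ρ (suc (suc x)) e = contradiction
      (to (proj₂ (cornerQuads G (suc (suc x)) (suc ρ) refl (twin-rows x) refl (twin-rows (suc x)))) e)
      (twin-¬evenQuad (occ G (suc (suc x)) (suc ρ)) (occ G (suc x) (suc ρ)))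

    ¬evenCorner₁-ρ : ¬ EvenCorner G 1 ρ
    ¬evenCorner₁-ρ e =
      contradiction (to (proj₂ (cornerQuads G 1 ρ column₁-ρ se-column₀ column₀-ρ se-column₁)) e) λ ()

    ¬evenCornerQ₀-ρ : ¬ EvenCorner Q 0 ρ
    ¬evenCornerQ₀-ρ e = contradiction (to (proj₂ (cornerQuads Q 0 ρ Q₀-ρ refl refl se-Q)) e) λ ()

    ρ+1<m+2 : suc ρ < suc (suc m)
    ρ+1<m+2 = s≤s (m≤n⇒m≤1+n ρ<m)

    evenCorner-punchIn-⇔ : ∀ i j → EvenCorner G (punchInℕ 0 i) (punchInℕ (suc ρ) j) ⇔ EvenCorner Q i j
    evenCorner-punchIn-⇔ (suc i) j = proj₂ (corner-⇔ (suc i) j λ ())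
    evenCorner-punchIn-⇔ zero    j with j ≟ℕ ρ
    ... | no j≢ρ   = proj₂ (corner-⇔ 0 j λ (_ , j≡ρ) → j≢ρ j≡ρ)
    ... | yes refl = mk⇔ (λ e → contradiction (subst (EvenCorner G 1) (punchInℕ-< (n<1+n ρ)) e) ¬evenCorner₁-ρ)
                         (λ e → contradiction e ¬evenCornerQ₀-ρ)

    -- The odd graph of G extends that of Q by the point (1, ρ+1), provided column 1 of G carries
    -- no other odd corner; that is not a local fact, but it is equivalent to column 0 of Q
    -- carrying no odd corner besides (0, ρ).
    oddCorner-punchIn-⇔ : (∀ j → OddCorner Q 0 j → j ≡ ρ) →
      ∀ i j → OddCorner G (punchInℕ 1 i) (punchInℕ (suc ρ) j) ⇔ OddCorner Q i j
    oddCorner-punchIn-⇔ _  (suc i) j = proj₁ (corner-⇔ (suc i) j λ ())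
    oddCorner-punchIn-⇔ Q₀ zero    j = mk⇔
      (λ o → subst (OddCorner Q 0) (sym (punchInℕ-sucˡ-≡ ρ (oddCorner₀ _ o))) oddCornerQ₀-ρ)
      (λ o → subst (OddCorner G 0) (sym (trans (cong (punchInℕ (suc ρ)) (Q₀ j o)) (punchInℕ-< (n<1+n ρ))))
               oddCorner₀-ρ)

    odd₁⇒odd₀ : (∀ y → OddCorner G 1 y → y ≡ suc ρ) → ∀ j → OddCorner Q 0 j → j ≡ ρ
    odd₁⇒odd₀ G₁ j o with j ≟ℕ ρ
    ... | yes j≡ρ = j≡ρ
    ... | no j≢ρ  = contradiction (G₁ _ (from (proj₁ (corner-⇔ 0 j λ (_ , j≡ρ) → j≢ρ j≡ρ)) o))
                                  (punchInℕᵢ≢i (suc ρ) j)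

    odd₀⇒odd₁ : (∀ j → OddCorner Q 0 j → j ≡ ρ) → ∀ y → OddCorner G 1 y → y ≡ suc ρ
    odd₀⇒odd₁ Q₀ y o with punchedℕ (suc ρ) y
    ... | here    = refl
    ... | there j with j ≟ℕ ρ
    ...   | yes refl = contradiction (subst (OddCorner G 1) (punchInℕ-< (n<1+n ρ)) o) ¬oddCorner₁-ρ
    ...   | no j≢ρ   = contradiction (Q₀ j (to (proj₁ (corner-⇔ 0 j λ (_ , j≡ρ) → j≢ρ j≡ρ)) o)) j≢ρ

  evenCorners-⇔ : PermGraphℕ (suc (suc m)) (EvenCorner G) ⇔ PermGraphℕ (suc m) (EvenCorner Q)
  evenCorners-⇔ = mk⇔
    (permGraphℕ-remove (EvenCorner G) (EvenCorner Q) (s≤s z≤n) ρ+1<m+2 evenCorner₀ evenCorner-punchIn-⇔)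
    (permGraphℕ-insert (EvenCorner G) (EvenCorner Q) (s≤s z≤n) ρ+1<m+2 evenCorner₀ evenCorner-punchIn-⇔
      evenCorner₀-suc-ρ evenCorner-suc-ρ)

  oddCorners-⇔ : PermGraphℕ (suc (suc m)) (OddCorner G) ⇔ PermGraphℕ (suc m) (OddCorner Q)
  oddCorners-⇔ = mk⇔ remove′ insert′
    where
    remove′ : PermGraphℕ (suc (suc m)) (OddCorner G) → PermGraphℕ (suc m) (OddCorner Q)
    remove′ graph = permGraphℕ-remove (OddCorner G) (OddCorner Q) (s≤s (s≤s z≤n)) ρ+1<m+2
      G₁ (oddCorner-punchIn-⇔ (odd₁⇒odd₀ G₁)) graph
      where
      G₁ : ∀ y → OddCorner G 1 y → y ≡ suc ρ
      G₁ y o = permGraphℕ-functional (oddCorner-bounded G) graph o oddCorner₁-suc-ρ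
    insert′ : PermGraphℕ (suc m) (OddCorner Q) → PermGraphℕ (suc (suc m)) (OddCorner G)
    insert′ graph = permGraphℕ-insert (OddCorner G) (OddCorner Q) (s≤s (s≤s z≤n)) ρ+1<m+2
      (odd₀⇒odd₁ Q₀) (oddCorner-punchIn-⇔ Q₀) oddCorner₁-suc-ρ oddCorner-suc-ρ graph
      where
      Q₀ : ∀ j → OddCorner Q 0 j → j ≡ ρ
      Q₀ j o = permGraphℕ-functional (oddCorner-bounded Q) graph o oddCornerQ₀-ρ

  private
    shrink grow : ℕ × ℕ → ℕ × ℕ
    shrink (x , y) = pred x , pinchℕ ρ y
    grow   (x , y) = suc x , punchInℕ ρ y

    shrink-occ : ∀ a → Occ G a → Occ Q (shrink a)
    shrink-occ (zero , y) o = subst (λ t → Occ Q (0 , pinchℕ ρ t)) (sym (column₀ y o))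
                                (subst (λ t → Occ Q (0 , t)) (sym (pinchℕ-self ρ)) Q₀-ρ)
    shrink-occ (suc x , y) o = trans (sym (cells-pinch x y)) o

    grow-occ : ∀ a → Occ Q a → Occ G (grow a)
    grow-occ (x , y) o = trans (sym (cells x y)) o

    pinch-twins : pinchℕ ρ ρ ≡ pinchℕ ρ (suc ρ)
    pinch-twins = trans (pinchℕ-self ρ) (sym (pinchℕ-suc-self ρ))

    twin-step : ∀ {x} → Occ G (suc x , ρ) → Path G (suc x , ρ) (grow (shrink (suc x , ρ)))
    twin-step {x} o = subst (λ t → Path G (suc x , ρ) (suc x , t)) grow-shrink-ρ
                        ((o , trans (sym (twin-rows x)) o , inj₁ (refl , inj₁ refl)) ◅ ε)
      where
      grow-shrink-ρ : suc ρ ≡ punchInℕ ρ (pinchℕ ρ ρ)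
      grow-shrink-ρ = sym (trans (cong (punchInℕ ρ) (pinchℕ-self ρ)) (punchInℕ-≥ ≤-refl))

    reach-G : ∀ a → Occ G a → ∃ λ b → Occ Q b × Path G a (grow b)
    reach-G a o = shrink a , shrink-occ a o , path a o
      where
      path : ∀ a → Occ G a → Path G a (grow (shrink a))
      path (zero , y) o = subst (λ t → Path G (0 , t) (grow (shrink (0 , t)))) (sym (column₀ y o))
        ((column₀-ρ , column₁-ρ , inj₂ (refl , inj₁ refl)) ◅ twin-step column₁-ρ)
      path (suc x , y) o with y ≟ℕ ρ
      ... | yes y≡ρ = subst (λ t → Path G (suc x , t) (grow (shrink (suc x , t)))) (sym y≡ρ)
                        (twin-step (subst (λ t → Occ G (suc x , t)) y≡ρ o))
      ... | no y≢ρ  = subst (λ t → Path G (suc x , y) (suc x , t)) (sym (punchInℕ-pinchℕ ρ y≢ρ)) ε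

    reach-Q : ∀ a → Occ Q a → ∃ λ b → Occ G b × Path Q a (shrink b)
    reach-Q (x , y) o = grow (x , y) , grow-occ (x , y) o ,
      subst (λ t → Path Q (x , y) (x , t)) (sym (pinchℕ-punchInℕ ρ y)) ε

    up-G : ∀ {x y} → Occ G (x , y) → Occ G (x , suc y) → Path Q (shrink (x , y)) (shrink (x , suc y))
    up-G {x} {y} o o′ with y ≟ℕ ρ
    ... | yes y≡ρ = subst (λ t → Path Q (pred x , pinchℕ ρ t) (pred x , pinchℕ ρ (suc t))) (sym y≡ρ)
                      (subst (λ t → Path Q (pred x , pinchℕ ρ ρ) (pred x , t)) pinch-twins ε)
    ... | no y≢ρ  =
      (shrink-occ (x , y) o , shrink-occ (x , suc y) o′ , inj₁ (refl , inj₁ (sym (pinchℕ-suc ρ y≢ρ)))) ◅ ε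

    right-G : ∀ {x y} → Occ G (x , y) → Occ G (suc x , y) → Path Q (shrink (x , y)) (shrink (suc x , y))
    right-G {zero}  o o′ = ε
    right-G {suc x} {y} o o′ =
      (shrink-occ (suc x , y) o , shrink-occ (suc (suc x) , y) o′ , inj₂ (refl , inj₁ refl)) ◅ ε

    up-Q : ∀ {x y} → Occ Q (x , y) → Occ Q (x , suc y) → Path G (grow (x , y)) (grow (x , suc y))
    up-Q {x} {y} o o′ with suc y ≟ℕ ρ
    ... | no y+1≢ρ =
      (grow-occ (x , y) o , grow-occ (x , suc y) o′ , inj₁ (refl , inj₁ (sym (punchInℕ-sucʳ ρ y+1≢ρ)))) ◅ ε
    ... | yes y+1≡ρ =
      (grow-occ (x , y) o , below-twin , inj₁ (refl , inj₁ (trans (cong suc (punchInℕ-< (≤-reflexive y+1≡ρ))) y+1≡ρ)))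
      ◅ (below-twin , grow-occ (x , suc y) o′ , inj₁ (refl , inj₁ (sym top))) ◅ ε
      where
      top : punchInℕ ρ (suc y) ≡ suc ρ
      top = trans (cong (punchInℕ ρ) y+1≡ρ) (punchInℕ-≥ ≤-refl)
      below-twin : Occ G (suc x , ρ)
      below-twin = trans (twin-rows x) (subst (λ t → Occ G (suc x , t)) top (grow-occ (x , suc y) o′))

    right-Q : ∀ {x y} → Occ Q (x , y) → Occ Q (suc x , y) → Path G (grow (x , y)) (grow (suc x , y))
    right-Q {x} {y} o o′ = (grow-occ (x , y) o , grow-occ (suc x , y) o′ , inj₂ (refl , inj₁ refl)) ◅ ε

  connected-⇔ : Connected G ⇔ Connected Q
  connected-⇔ = mk⇔
    (connected-transfer {g = G} {h = Q} shrink (λ {x} {y} → up-G {x} {y}) (λ {x} {y} → right-G {x} {y}) reach-Q)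
    (connected-transfer {g = Q} {h = G} grow up-Q right-Q reach-G)

  rowConvex-⇔ : RowConvex G ⇔ RowConvex Q
  rowConvex-⇔ = mk⇔ to′ from′
    where
    to′ : RowConvex G → RowConvex Q
    to′ conv y x₁ x₂ x₃ l₁ l₂ o₁ o₃ = trans (cells x₂ y)
      (conv _ (suc x₁) (suc x₂) (suc x₃) (s≤s l₁) (s≤s l₂) (grow-occ (x₁ , y) o₁) (grow-occ (x₃ , y) o₃))
    from′ : RowConvex Q → RowConvex G
    from′ conv y zero    zero     _        _  _          o₁ _  = o₁
    from′ conv y x₁      (suc x₂) (suc x₃) l₁ (s≤s l₂) o₁ o₃ = trans (cells-pinch x₂ y)
      (conv _ (pred x₁) x₂ x₃ (pred-mono-≤ l₁) l₂ (shrink-occ (x₁ , y) o₁) (shrink-occ (suc x₃ , y) o₃))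

  colConvex-⇔ : ColConvex G ⇔ ColConvex Q
  colConvex-⇔ = mk⇔ to′ from′
    where
    to′ : ColConvex G → ColConvex Q
    to′ conv x y₁ y₂ y₃ l₁ l₂ o₁ o₃ = trans (cells x y₂)
      (conv (suc x) _ _ _ (punchInℕ-mono-≤ ρ l₁) (punchInℕ-mono-≤ ρ l₂)
        (grow-occ (x , y₁) o₁) (grow-occ (x , y₃) o₃))
    from′ : ColConvex Q → ColConvex G
    from′ conv zero    y₁ y₂ y₃ l₁ l₂ o₁ o₃ = subst (λ t → Occ G (0 , t)) (sym y₂≡ρ) column₀-ρ
      where
      y₂≡ρ : y₂ ≡ ρ
      y₂≡ρ = ≤-antisym (subst (y₂ ≤_) (column₀ y₃ o₃) l₂) (subst (_≤ y₂) (column₀ y₁ o₁) l₁)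
    from′ conv (suc x) y₁ y₂ y₃ l₁ l₂ o₁ o₃ = trans (cells-pinch x y₂)
      (conv x _ _ _ (pinchℕ-mono-≤ ρ l₁) (pinchℕ-mono-≤ ρ l₂)
        (shrink-occ (suc x , y₁) o₁) (shrink-occ (suc x , y₃) o₃))

  rowsNonempty-⇔ : RowsNonempty G ⇔ RowsNonempty Q
  rowsNonempty-⇔ = mk⇔ to′ from′
    where
    to′ : RowsNonempty G → RowsNonempty Q
    to′ rows y y<m with rows (punchInℕ ρ y) (s≤s (≤-trans (punchInℕ≤suc ρ y) y<m))
    ... | zero  , o = contradiction (column₀ _ o) (punchInℕᵢ≢i ρ y)
    ... | suc x , o = x , trans (cells x y) o
    from′ : RowsNonempty Q → RowsNonempty G
    from′ rows y y<m+1 with rows (pinchℕ ρ y) (pinchℕ< ρ y<m+1 ρ<m)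
    ... | x , o = suc x , trans (cells-pinch x y) o

  colsNonempty-⇔ : ColsNonempty G ⇔ ColsNonempty Q
  colsNonempty-⇔ = mk⇔ to′ from′
    where
    to′ : ColsNonempty G → ColsNonempty Q
    to′ cols x x<m with cols (suc x) (s≤s x<m)
    ... | y , o = pinchℕ ρ y , trans (sym (cells-pinch x y)) o
    from′ : ColsNonempty Q → ColsNonempty G
    from′ cols zero    _ = ρ , column₀-ρ
    from′ cols (suc x) (s≤s x<m) with cols x x<m
    ... | y , o = punchInℕ ρ y , grow-occ (x , y) o

  convexPermutomino-⇔ : ConvexPermutomino (suc m) G ⇔ ConvexPermutomino m Q
  convexPermutomino-⇔ = rowsNonempty-⇔ ×-⇔ colsNonempty-⇔ ×-⇔ connected-⇔ ×-⇔
    rowConvex-⇔ ×-⇔ colConvex-⇔ ×-⇔ oddCorners-⇔ ×-⇔ evenCorners-⇔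

  active : ConvexPermutomino m Q → Active (suc m) G
  active cp = from convexPermutomino-⇔ cp , (ρ , column₀-ρ , column₀) , (suc ρ , α) , α-abscissa
    where
    α : Alpha G 1 (suc ρ)
    α = column₀-suc-ρ , column₁-suc-ρ , column₁-ρ , column₀-ρ
    α-abscissa : ∀ i j → Alpha G i j → 1 ≤ i
    α-abscissa zero    j (_ , _ , _ , ())
    α-abscissa (suc i) j _ = s≤s z≤n

  ψ-inverse : ψ G ≡ Q
  ψ-inverse = occ-ext (ψ G) Q λ x y → trans (ψ-occ G lowest x y) (sym (cells x y))
    where
    lowest : LowestInColumn₀ G ρ
    lowest = column₀-ρ , λ y y<ρ → column₀-false (<⇒≢ y<ρ)

  φ-inverse : RowConvex G → φ Q ≡ G
  φ-inverse row-convex = occ-ext (φ Q) G λ x y → φ-occ x y (punchedℕ ρ y)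
    where
    lowest : LowestInColumn₀ Q ρ
    lowest = Q₀-ρ , λ y y<ρ → trans (cells 0 y) (trans (cong (occ G 1) (punchInℕ-< y<ρ)) (column₁-below y y<ρ))
    φ-occ : ∀ x y → Punchedℕ ρ y → occ (φ Q) x y ≡ occ G x y
    φ-occ zero    _ here       = trans (φ-occ-zero-ρ Q lowest) (sym column₀-ρ)
    φ-occ (suc x) _ here       = begin
      occ (φ Q) (suc x) ρ                        ≡⟨ φ-occ-suc-ρ Q lowest x ⟩
      occ Q x ρ ∨ occ Q (suc x) ρ                ≡⟨ cong₂ _∨_ (cells-ρ x) (cells-ρ (suc x)) ⟩
      occ G (suc x) ρ ∨ occ G (suc (suc x)) ρ
        ≡⟨ ∨-redundantʳ (row-convex ρ 0 (suc x) (suc (suc x)) z≤n (n≤1+n _) column₀-ρ) ⟩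
      occ G (suc x) ρ                            ∎
      where open ≡-Reasoning
    φ-occ zero    _ (there y) = trans (φ-occ-zero-punchIn Q lowest y) (sym (column₀-false (punchInℕᵢ≢i ρ y)))
    φ-occ (suc x) _ (there y) = trans (φ-occ-suc-punchIn Q lowest x y) (cells x y)

module _ {m} {G : Grid (suc m)} (cp : ConvexPermutomino (suc m) G)
  {ρ} (column₀-ρ : Occ G (0 , ρ)) (column₀ : ∀ y → Occ G (0 , y) → y ≡ ρ)
  {j} (α : Alpha G 1 j) where
  open Equivalence
  private
    column₀-false : ∀ {y} → y ≢ ρ → occ G 0 y ≡ false
    column₀-false y≢ρ = ¬-not (λ o → y≢ρ (column₀ _ o))

    column₁-around-ρ : ∀ {j} → Alpha G 1 j → Occ G (1 , suc ρ) × Occ G (1 , ρ)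
    column₁-around-ρ {suc y} (_ , ne , se , sw) with column₀ y sw
    ... | refl = ne , se

    column₁-ρ : Occ G (1 , ρ)
    column₁-ρ = proj₂ (column₁-around-ρ α)

    column₁-suc-ρ : Occ G (1 , suc ρ)
    column₁-suc-ρ = proj₁ (column₁-around-ρ α)

    column₀-suc-ρ : occ G 0 (suc ρ) ≡ false
    column₀-suc-ρ = column₀-false 1+n≢n

    oddCorner₁-suc-ρ : OddCorner G 1 (suc ρ)
    oddCorner₁-suc-ρ =
      from (proj₁ (cornerQuads G 1 (suc ρ) column₁-suc-ρ column₀-ρ column₀-suc-ρ column₁-ρ)) refl

    evenCorner₀-suc-ρ : EvenCorner G 0 (suc ρ)
    evenCorner₀-suc-ρ = from (proj₂ (cornerQuads G 0 (suc ρ) column₀-suc-ρ refl refl column₀-ρ)) refl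

    twin-rows : ∀ x → occ G (suc x) ρ ≡ occ G (suc x) (suc ρ)
    twin-rows zero    = trans column₁-ρ (sym column₁-suc-ρ)
    twin-rows (suc x) with occ G (suc x) ρ in a | occ G (suc (suc x)) ρ in c | occ G (suc (suc x)) (suc ρ) in d
    ... | _     | false | false = refl
    ... | _     | true  | true  = refl
    ... | false | true  | _     = contradiction
      (rowConvex cp ρ 0 (suc x) (suc (suc x)) z≤n (n≤1+n _) column₀-ρ c)
      (λ o → contradiction (trans (sym o) a) λ ())
    ... | false | _     | true  = contradiction
      (rowConvex cp (suc ρ) 1 (suc x) (suc (suc x)) (s≤s z≤n) (n≤1+n _) column₁-suc-ρ d)
      (λ o → contradiction (trans (sym o) (trans (sym (twin-rows x)) a)) λ ())
    ... | true  | true  | false = contradiction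
      (evenCorner-injective cp {suc (suc x)} {0} {suc ρ}
        (from (proj₂ (cornerQuads G (suc (suc x)) (suc ρ) d a (trans (sym (twin-rows x)) a) c)) refl)
        evenCorner₀-suc-ρ)
      λ ()
    ... | true  | false | true  = contradiction
      (oddCorner-injective cp {suc (suc x)} {1} {suc ρ}
        (from (proj₁ (cornerQuads G (suc (suc x)) (suc ρ) d a (trans (sym (twin-rows x)) a) c)) refl)
        oddCorner₁-suc-ρ)
      λ ()

    -- The lowest cell of column 1 would carry an odd corner below the one at (1, ρ+1).
    column₁-below : ∀ y → y < ρ → occ G 1 y ≡ false
    column₁-below y y<ρ = ¬-not λ o →
      <⇒≢ (<-trans y<ρ (n<1+n ρ)) (oddCorner-functional cp (corner o) oddCorner₁-suc-ρ)
      where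
      se-below : ∀ y → y < ρ → occ′ G 2 y ≡ false
      se-below zero    _     = refl
      se-below (suc y) y+1<ρ = column₁-below y (<-trans (n<1+n y) y+1<ρ)
      sw-below : occ′ G 1 y ≡ false
      sw-below = occ′-below G 0 y λ e → column₀-false (<⇒≢ (<-trans (n<1+n _) (subst (_< ρ) (sym e) y<ρ)))
      corner : Occ G (1 , y) → OddCorner G 1 y
      corner o = from (proj₁ (cornerQuads G 1 y o sw-below (column₀-false (<⇒≢ y<ρ)) (se-below y y<ρ))) refl

  ψ-rowInsertion : RowInsertion G (ψ G) ρ
  ψ-rowInsertion = record
    { cells         = λ x y → ψ-occ G (column₀-ρ , λ y y<ρ → column₀-false (<⇒≢ y<ρ)) x y
    ; ρ<m           = s≤s⁻¹ (proj₂ (occ-bounded G {1} column₁-suc-ρ))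
    ; column₀       = column₀
    ; column₀-ρ     = column₀-ρ
    ; twin-rows     = twin-rows
    ; column₁-ρ     = column₁-ρ
    ; column₁-below = column₁-below
    }

module _ {m} {Q : Grid m} (cp : ConvexPermutomino m Q) {ρ} (lowest : LowestInColumn₀ Q ρ) where
  private
    column₀ : ∀ y → Occ (φ Q) (0 , y) → y ≡ ρ
    column₀ y o with punchedℕ ρ y
    ... | here    = refl
    ... | there y′ = contradiction (trans (sym o) (φ-occ-zero-punchIn Q lowest y′)) λ ()

    φ-occ-ρ : ∀ x → occ (φ Q) (suc x) ρ ≡ occ Q x ρ
    φ-occ-ρ x = trans (φ-occ-suc-ρ Q lowest x)
      (∨-redundantʳ (rowConvex cp ρ 0 x (suc x) z≤n (n≤1+n x) (proj₁ lowest)))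

  φ-rowInsertion : RowInsertion (φ Q) Q ρ
  φ-rowInsertion = record
    { cells         = λ x y → sym (φ-occ-suc-punchIn Q lowest x y)
    ; ρ<m           = proj₂ (occ-bounded Q {0} (proj₁ lowest))
    ; column₀       = column₀
    ; column₀-ρ     = φ-occ-zero-ρ Q lowest
    ; twin-rows     = λ x → trans (φ-occ-ρ x) (trans (sym (φ-occ-suc-punchIn Q lowest x ρ))
                                (cong (occ (φ Q) (suc x)) (punchInℕ-≥ ≤-refl)))
    ; column₁-ρ     = trans (φ-occ-ρ 0) (proj₁ lowest)
    ; column₁-below = λ y y<ρ → trans (cong (occ (φ Q) 1) (sym (punchInℕ-< y<ρ)))
                                  (trans (φ-occ-suc-punchIn Q lowest 0 y) (proj₂ lowest y y<ρ))
    }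

active⇒rowInsertion : ∀ {m} {P : Grid (suc m)} → Active (suc m) P → ∃ (RowInsertion P (ψ P))
active⇒rowInsertion (cp , (ρ , column₀-ρ , column₀) , (_ , α) , _) = ρ , ψ-rowInsertion cp column₀-ρ column₀ α

convex⇒rowInsertion : ∀ {m} {Q : Grid m} → 1 ≤ m → ConvexPermutomino m Q → ∃ (RowInsertion (φ Q) Q)
convex⇒rowInsertion {Q = Q} 1≤m cp with lowestInColumn₀-exists Q (proj₂ (colsNonempty cp 0 1≤m))
... | ρ , lowest = ρ , φ-rowInsertion cp lowest

mainTheorem1 : (m : ℕ) → 1 ≤ m →
    ((P : Grid (suc m)) → Active (suc m) P → ConvexPermutomino m (ψ P)) ×
    ((P′ : Grid m) → ConvexPermutomino m P′ → Active (suc m) (φ P′)) ×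
    ((P : Grid (suc m)) → Active (suc m) P → φ (ψ P) ≡ P) ×
    ((P′ : Grid m) → ConvexPermutomino m P′ → ψ (φ P′) ≡ P′)
mainTheorem1 m 1≤m =
  (λ P act → Equivalence.to (convexPermutomino-⇔ (proj₂ (active⇒rowInsertion act))) (proj₁ act)) ,
  (λ P′ cp → active (proj₂ (convex⇒rowInsertion 1≤m cp)) cp) ,
  (λ P act → φ-inverse (proj₂ (active⇒rowInsertion act)) (rowConvex (proj₁ act))) ,
  (λ P′ cp → ψ-inverse (proj₂ (convex⇒rowInsertion 1≤m cp)))
  where open RowInsertionProperties
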